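{- Let $p,d\geq1$ and $\epsilon\in\{+1,-1\}^{p\times d}$. For $1\leq i\leq p$, $1\leq j\leq d$ let $\chi^+(i,j)=1$ if $\epsilon_{ij}=+1$ and $0$ otherwise, and $\chi^-(i,j)=1-\chi^+(i,j)$; set $\chi^\pm(0,j)=0$ for $1\leq j\leq d$ (row $0$ is a dummy row with no sign). Define integers $N_s(i,j)$ for $s\in\{+,-,+-,-+\}$, $0\leq i\leq p+1$, $1\leq j\leq d+1$, and $N_1(0,j)$ for $1\leq j\leq d+1$ by the boundary conditions $N_s(i,d+1)=0$ for all $i$ and $s$, $N_1(0,d+1)=0$, $N_{+- }(p+1,j)=N_{ -+}(p+1,j)=1$ and $N_+(p+1,j)=N_-(p+1,j)=0$ for $1\leq j\leq d$, and, for $0\leq i\leq p$, $1\leq j\leq d$, the recursions \begin{align*} N_1(0,j)&=N_1(0,j+1)+N_{+- }(1,j),\\ N_+(i,j)&=N_+(i,j+1)+\chi^-(i,j)N_{+- }(i+1,j),\\ N_-(i,j)&=N_-(i,j+1)+\chi^+(i,j)N_{ -+}(i+1,j),\\ N_{+- }(i,j)&=\chi^+(i,j)N_{+- }(i+1,j)+\chi^+(i,j)N_+(i,j+1)+\chi^-(i,j)N_-(i,j+1),\\ N_{ -+}(i,j)&=\chi^-(i,j)N_-(i,j+1)+\chi^+(i,j)N_{ -+}(i+1,j). \end{align*} Then the number of tropically allowed lattice paths for $\epsilon$ equals $N_1(0,1)$.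
   Context: A lattice path in the $p\times d$ grid is given by $k\geq0$ and $1\leq i_1<\cdots<i_k\leq p$, $1\leq j_1<\cdots<j_{k+1}\leq d$; it is the sequence of positions $(1,j_1),\ldots,(i_1,j_1),\ldots,(i_1,j_2),\ldots,(i_2,j_2),\ldots,(i_k,j_{k+1}),\ldots,(p,j_{k+1})$. It is tropically allowed for $\epsilon$ if: (C1) if $k\geq1$, $\epsilon_{ij_1}=+1$ for $1\leq i<i_1$; (C2) if $k\geq1$, $\epsilon_{ij_{k+1}}=+1$ for $i_k<i\leq p$, and if $k=0$, $\epsilon_{ij_1}=+1$ for all $1\leq i\leq p$; (C3) for $2\leq r\leq k$, $\epsilon_{ij_r}=+1$ for $i_{r-1}<i<i_r$; (C4) for each $1\leq r\leq k$, $(\epsilon_{i_rj_r},\epsilon_{i_rj_{r+1}})\in\{(+1,-1),(-1,+1)\}$; (C5) if $(\epsilon_{i_rj_r},\epsilon_{i_rj_{r+1}})=(-1,+1)$ for some $r$, then $(\epsilon_{i_sj_s},\epsilon_{i_sj_{s+1}})=(-1,+1)$ for all $r\leq s\leq k$. -}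

module Defs where

open import Data.Nat using (ℕ; zero; suc; _+_; _*_; _∸_; _≤_; _<_; _<?_)
open import Data.Fin using (Fin; toℕ; fromℕ; fromℕ<; inject₁) renaming (zero to fzero; suc to fsuc)
open import Data.Vec using (Vec; []; _∷_; lookup)
open import Data.Product using (_×_; Σ; ∃-syntax)
open import Data.Sum using (_⊎_)
open import Data.Unit using (⊤)
open import Relation.Binary.PropositionalEquality using (_≡_)
open import Relation.Nullary using (yes; no)
open import Function.Definitions using (Injective)

data Sign : Set where
  plus minus : Sign

Increasing : ∀ {n m} → Vec (Fin n) m → Set
Increasing [] = ⊤
Increasing (x ∷ []) = ⊤
Increasing (x ∷ y ∷ v) = (toℕ x < toℕ y) × Increasing (y ∷ v)

-- Indices are stored 0-based as Fin p / Fin d (row i ↦ i-1, column j ↦ j-1),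
-- and position r of a vector stores i_{r+1} resp. j_{r+1}.
record LatticePath (p d : ℕ) : Set where
  constructor mkPath
  field
    k     : ℕ
    is    : Vec (Fin p) k
    js    : Vec (Fin d) (suc k)
    is-incr : Increasing is
    js-incr : Increasing js

record TropAllowed {p d : ℕ} (ε : Fin p → Fin d → Sign) (π : LatticePath p d) : Set where
  open LatticePath π
  -- i_{r+1} and j_{r+1} for 0-based r
  I : Fin k → Fin p
  I r = lookup is r
  J : Fin (suc k) → Fin d
  J r = lookup js r
  field
    C1 : (r : Fin k) → toℕ r ≡ 0 →
         (i : Fin p) → toℕ i < toℕ (I r) → ε i (J (inject₁ r)) ≡ plus
    C2 : (r : Fin k) → suc (toℕ r) ≡ k →
         (i : Fin p) → toℕ (I r) < toℕ i → ε i (J (fromℕ k)) ≡ plus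
    C2₀ : k ≡ 0 → (i : Fin p) → ε i (J (fromℕ k)) ≡ plus
    C3 : (s t : Fin k) → toℕ t ≡ suc (toℕ s) →
         (i : Fin p) → toℕ (I s) < toℕ i → toℕ i < toℕ (I t) →
         ε i (J (inject₁ t)) ≡ plus
    C4 : (r : Fin k) →
         (ε (I r) (J (inject₁ r)) ≡ plus × ε (I r) (J (fsuc r)) ≡ minus)
         ⊎ (ε (I r) (J (inject₁ r)) ≡ minus × ε (I r) (J (fsuc r)) ≡ plus)
    C5 : (r s : Fin k) → toℕ r ≤ toℕ s →
         (ε (I r) (J (inject₁ r)) ≡ minus × ε (I r) (J (fsuc r)) ≡ plus) →
         (ε (I s) (J (inject₁ s)) ≡ minus × ε (I s) (J (fsuc s)) ≡ plus)

-- The counts N_s(i,j), computed in ℕ (all recursions have nonnegative coefficients).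
data Kind : Set where
  K+ K- K+- K-+ : Kind

module Counts {p d : ℕ} (ε : Fin p → Fin d → Sign) where

  isPlus isMinus : Sign → ℕ
  isPlus plus = 1
  isPlus minus = 0
  isMinus plus = 0
  isMinus minus = 1

  -- χ⁺(i,j), χ⁻(i,j) with 1-based i ∈ [0,p] (row 0 is the dummy row), j ∈ [1,d]
  χ⁺ χ⁻ : ℕ → ℕ → ℕ
  χ⁺ zero j = 0
  χ⁺ (suc i) zero = 0
  χ⁺ (suc i) (suc j) with i <? p | j <? d
  ... | yes hi | yes hj = isPlus (ε (fromℕ< hi) (fromℕ< hj))
  ... | _ | _ = 0
  χ⁻ zero j = 0
  χ⁻ (suc i) zero = 0
  χ⁻ (suc i) (suc j) with i <? p | j <? d
  ... | yes hi | yes hj = isMinus (ε (fromℕ< hi) (fromℕ< hj))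
  ... | _ | _ = 0

  -- Nc s a b = N_s(p+1-a, d+1-b), for 0 ≤ a ≤ p+1, 0 ≤ b ≤ d.
  Nc : Kind → ℕ → ℕ → ℕ
  Nc s a zero = 0
  Nc K+ zero (suc b) = 0
  Nc K- zero (suc b) = 0
  Nc K+- zero (suc b) = 1
  Nc K-+ zero (suc b) = 1
  Nc K+ (suc a) (suc b) =
    Nc K+ (suc a) b + χ⁻ (p ∸ a) (d ∸ b) * Nc K+- a (suc b)
  Nc K- (suc a) (suc b) =
    Nc K- (suc a) b + χ⁺ (p ∸ a) (d ∸ b) * Nc K-+ a (suc b)
  Nc K+- (suc a) (suc b) =
    χ⁺ (p ∸ a) (d ∸ b) * Nc K+- a (suc b)
    + χ⁺ (p ∸ a) (d ∸ b) * Nc K+ (suc a) b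
    + χ⁻ (p ∸ a) (d ∸ b) * Nc K- (suc a) b
  Nc K-+ (suc a) (suc b) =
    χ⁻ (p ∸ a) (d ∸ b) * Nc K- (suc a) b
    + χ⁺ (p ∸ a) (d ∸ b) * Nc K-+ a (suc b)

  N : Kind → ℕ → ℕ → ℕ
  N s i j = Nc s (suc p ∸ i) (suc d ∸ j)

  -- N₁c b = N₁(0, d+1-b)
  N₁c : ℕ → ℕ
  N₁c zero = 0
  N₁c (suc b) = N₁c b + N K+- 1 (d ∸ b)

  N₁₀ : ℕ → ℕ
  N₁₀ j = N₁c (suc d ∸ j)

CountIs : {A : Set} → (A → Set) → ℕ → Set
CountIs {A} P n =
  Σ (Fin n → A) λ f → Injective _≡_ _≡_ f × ((x : Fin n) → P (f x))
    × ((a : A) → P a → ∃[ x ] (f x ≡ a))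

-- Read a lattice path from the top row down. At a cell (i, j) of its current column it
-- either moves down, which is allowed only through a +1 cell, or turns right into a
-- later column j', which requires (ε_ij, ε_ij') = (+1,-1) or (-1,+1); after a (-1,+1)
-- turn only (-1,+1) turns remain possible (C5). Classifying the tails that start at a
-- cell by this first move gives exactly the recursions of N_{+-} (no (-1,+1) turn yet)
-- and N_{-+} (after one), while N_+ and N_- count the tails that continue a turn in a
-- given row further to the right. The row-0 recursion for N_1 sums over the first column.
module Submission where

open import Defs
open import Data.Nat using (ℕ; zero; suc; _+_; _*_; _∸_; _≤_; _<_; z≤n; s≤s; _<?_)
open import Data.Nat.Properties
  using (≤-refl; ≤-trans; <⇒≤; <⇒≱; <-irrefl; ≤-reflexive; ≤-irrelevant; m≤n⇒m<n∨m≡n; m<m+n;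
         +-suc; +-identityʳ; +-assoc; +-comm; *-identityˡ; m+n∸n≡m; m+n∸m≡n; suc-injective)
open import Data.Fin using (Fin; toℕ; fromℕ; fromℕ<; inject₁; splitAt; join; _↑ˡ_; _↑ʳ_)
  renaming (zero to fzero; suc to fsuc)
open import Data.Fin.Properties
  using (toℕ-injective; toℕ<n; toℕ-fromℕ<; splitAt-↑ˡ; splitAt-↑ʳ; join-splitAt)
open import Data.Vec using (Vec; []; _∷_; lookup)
open import Data.Product using (_×_; Σ; ∃-syntax; _,_; proj₁; proj₂)
open import Data.Sum using (_⊎_; inj₁; inj₂; [_,_]′)
open import Data.Unit using (⊤; tt)
open import Data.Empty using (⊥-elim)
open import Relation.Binary.PropositionalEquality using (_≡_; refl; sym; trans; cong; cong₂; subst; module ≡-Reasoning)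
open import Relation.Nullary using (yes; no; ¬_)
open import Function.Bundles using (_⇔_; mk⇔; Equivalence)
open import Function.Definitions using (Injective)

module _ {A : Set} where

  CountIs-subst : {P : A → Set} {m n : ℕ} → m ≡ n → CountIs P m → CountIs P n
  CountIs-subst refl c = c

  CountIs-cong : {P Q : A → Set} {n : ℕ} → (∀ a → P a ⇔ Q a) → CountIs P n → CountIs Q n
  CountIs-cong P⇔Q (f , f-inj , f-P , f-onto) =
    f , f-inj , (λ x → Equivalence.to (P⇔Q (f x)) (f-P x)) ,
    λ a q → f-onto a (Equivalence.from (P⇔Q a) q)

  CountIs-empty : {P : A → Set} → (∀ a → ¬ P a) → CountIs P 0
  CountIs-empty ¬P = (λ ()) , (λ { {()} }) , (λ ()) , λ a q → ⊥-elim (¬P a q)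

  CountIs-single : {P : A → Set} (a₀ : A) → P a₀ → (∀ a → P a → a₀ ≡ a) → CountIs P 1
  CountIs-single a₀ P-a₀ unique =
    (λ _ → a₀) , (λ { {fzero} {fzero} _ → refl }) , (λ _ → P-a₀) , λ a q → fzero , unique a q

  CountIs-⊎ : {P Q : A → Set} {m n : ℕ} → (∀ a → P a → ¬ Q a) →
              CountIs P m → CountIs Q n → CountIs (λ a → P a ⊎ Q a) (m + n)
  CountIs-⊎ {P} {Q} {m} {n} disjoint (f , f-inj , f-P , f-onto) (g , g-inj , g-Q , g-onto) =
    (λ x → h (splitAt m x)) , h∘split-inj , (λ x → h-PQ (splitAt m x)) , onto
    where
    h : Fin m ⊎ Fin n → A
    h = [ f , g ]′
    h-inj : ∀ u v → h u ≡ h v → u ≡ v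
    h-inj (inj₁ x) (inj₁ y) e = cong inj₁ (f-inj e)
    h-inj (inj₁ x) (inj₂ y) e = ⊥-elim (disjoint (g y) (subst P e (f-P x)) (g-Q y))
    h-inj (inj₂ x) (inj₁ y) e = ⊥-elim (disjoint (f y) (f-P y) (subst Q e (g-Q x)))
    h-inj (inj₂ x) (inj₂ y) e = cong inj₂ (g-inj e)
    h∘split-inj : Injective _≡_ _≡_ (λ x → h (splitAt m x))
    h∘split-inj {x} {y} e = begin
      x                       ≡⟨ join-splitAt m n x ⟨
      join m n (splitAt m x)  ≡⟨ cong (join m n) (h-inj (splitAt m x) (splitAt m y) e) ⟩
      join m n (splitAt m y)  ≡⟨ join-splitAt m n y ⟩
      y                       ∎
      where open ≡-Reasoning
    h-PQ : ∀ u → P (h u) ⊎ Q (h u)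
    h-PQ (inj₁ x) = inj₁ (f-P x)
    h-PQ (inj₂ y) = inj₂ (g-Q y)
    onto : ∀ a → P a ⊎ Q a → ∃[ x ] h (splitAt m x) ≡ a
    onto a (inj₁ q) with f-onto a q
    ... | x , fx≡a = x ↑ˡ n , trans (cong h (splitAt-↑ˡ m x n)) fx≡a
    onto a (inj₂ q) with g-onto a q
    ... | y , gy≡a = m ↑ʳ y , trans (cong h (splitAt-↑ʳ m n y)) gy≡a

  CountIs-image : {P : A → Set} {n : ℕ} (g : A → A) → Injective _≡_ _≡_ g →
                  CountIs P n → CountIs (λ b → ∃[ a ] P a × g a ≡ b) n
  CountIs-image g g-inj (f , f-inj , f-P , f-onto) =
    (λ x → g (f x)) , (λ e → f-inj (g-inj e)) , (λ x → f x , f-P x , refl) ,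
    λ { b (a , P-a , refl) → let (x , fx≡a) = f-onto a P-a in x , cong g fx≡a }

  CountIs-transport : {B : Set} {P : B → Set} {Q : A → Set} {n : ℕ}
    (g : B → A) → Injective _≡_ _≡_ g → (∀ b → P b → Q (g b)) →
    (∀ a → Q a → Σ B λ b → P b × g b ≡ a) → CountIs Q n → CountIs P n
  CountIs-transport {B} {P} {Q} {n} g g-inj P⇒Q lift (f , f-inj , f-Q , f-onto) =
    f′ , (λ e → f-inj (trans (sym (g∘f′ _)) (trans (cong g e) (g∘f′ _)))) ,
    (λ x → proj₁ (proj₂ (lift (f x) (f-Q x)))) , onto
    where
    f′ : Fin n → B
    f′ x = proj₁ (lift (f x) (f-Q x))
    g∘f′ : ∀ x → g (f′ x) ≡ f x
    g∘f′ x = proj₂ (proj₂ (lift (f x) (f-Q x)))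
    onto : ∀ b → P b → ∃[ x ] f′ x ≡ b
    onto b P-b with f-onto (g b) (P⇒Q b P-b)
    ... | x , fx≡gb = x , g-inj (trans (g∘f′ x) fx≡gb)

∸-≡-suc : ∀ {x a n} → x + suc a ≡ n → n ∸ a ≡ suc x
∸-≡-suc {x} {a} refl = trans (cong (_∸ a) (+-suc x a)) (m+n∸n≡m (suc x) a)

suc-∸-∸-≡-suc : ∀ {x a n} → x + suc a ≡ n → suc n ∸ (n ∸ a) ≡ suc a
suc-∸-∸-≡-suc {x} {a} refl = trans (cong (suc (x + suc a) ∸_) (∸-≡-suc {x} {a} refl)) (m+n∸m≡n x (suc a))

+-suc-shift : ∀ {x a n} → x + suc a ≡ n → suc x + a ≡ n
+-suc-shift {x} {a} e = trans (sym (+-suc x a)) e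

fromℕ-below : ∀ {n} i a → i + suc a ≡ n → Σ (Fin n) λ x → toℕ x ≡ i
fromℕ-below i a e = fromℕ< i<n , toℕ-fromℕ< i<n
  where
  i<n : i < _
  i<n = subst (i <_) e (m<m+n i (s≤s z≤n))

Increasing-irrelevant : ∀ {n m} (v : Vec (Fin n) m) (u w : Increasing v) → u ≡ w
Increasing-irrelevant [] tt tt = refl
Increasing-irrelevant (x ∷ []) tt tt = refl
Increasing-irrelevant (x ∷ y ∷ v) (x<y , u) (x<y′ , w) =
  cong₂ _,_ (≤-irrelevant x<y x<y′) (Increasing-irrelevant (y ∷ v) u w)

IncreasingFrom : ∀ {n m} → ℕ → Vec (Fin n) m → Set
IncreasingFrom i [] = ⊤
IncreasingFrom i (x ∷ v) = i ≤ toℕ x × IncreasingFrom (suc (toℕ x)) v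

IncreasingFrom⇒Increasing : ∀ {n m i} {v : Vec (Fin n) m} → IncreasingFrom i v → Increasing v
IncreasingFrom⇒Increasing {v = []} _ = tt
IncreasingFrom⇒Increasing {v = x ∷ []} _ = tt
IncreasingFrom⇒Increasing {v = x ∷ y ∷ v} (_ , x<y , rest) = x<y , IncreasingFrom⇒Increasing (x<y , rest)

Increasing⇒IncreasingFrom : ∀ {n m i} {x : Fin n} {v : Vec (Fin n) m} →
                             i ≤ toℕ x → Increasing (x ∷ v) → IncreasingFrom i (x ∷ v)
Increasing⇒IncreasingFrom {v = []} i≤x _ = i≤x , tt
Increasing⇒IncreasingFrom {v = y ∷ v} i≤x (x<y , inc) = i≤x , Increasing⇒IncreasingFrom x<y inc

Increasing⇒IncreasingFrom₀ : ∀ {n m} {v : Vec (Fin n) m} → Increasing v → IncreasingFrom 0 v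
Increasing⇒IncreasingFrom₀ {v = []} _ = tt
Increasing⇒IncreasingFrom₀ {v = x ∷ v} inc = Increasing⇒IncreasingFrom z≤n inc

-- In mode locked a (-1,+1) turn has already occurred, so by (C5) only (-1,+1) turns remain.
data Mode : Set where
  free locked : Mode

data Turn : Mode → Sign → Sign → Set where
  turn+- : Turn free plus minus
  turn-+ : ∀ {m} → Turn m minus plus

after : Mode → Sign → Mode
after m plus = m
after m minus = locked

after-locked : ∀ s → after locked s ≡ locked
after-locked plus = refl
after-locked minus = refl

after≡locked⇒ : ∀ m s → after m s ≡ locked → m ≡ locked ⊎ s ≡ minus
after≡locked⇒ m plus e = inj₁ e
after≡locked⇒ m minus e = inj₂ refl

Turns Ascent : Sign → Sign → Set
Turns a b = (a ≡ plus × b ≡ minus) ⊎ (a ≡ minus × b ≡ plus)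
Ascent a b = a ≡ minus × b ≡ plus

Turn⇒Turns : ∀ {m a b} → Turn m a b → Turns a b
Turn⇒Turns turn+- = inj₁ (refl , refl)
Turn⇒Turns turn-+ = inj₂ (refl , refl)

Turn-locked⇒Ascent : ∀ {a b} → Turn locked a b → Ascent a b
Turn-locked⇒Ascent turn-+ = refl , refl

Turns⇒Turn : ∀ m {a b} → Turns a b → (m ≡ locked → Ascent a b) → Turn m a b
Turns⇒Turn free (inj₁ (refl , refl)) _ = turn+-
Turns⇒Turn free (inj₂ (refl , refl)) _ = turn-+
Turns⇒Turn locked _ ascent with ascent refl
... | refl , refl = turn-+

Turns-minus⇒Ascent : ∀ {a b} → Turns a b → a ≡ minus → Ascent a b
Turns-minus⇒Ascent (inj₁ (refl , _)) ()
Turns-minus⇒Ascent (inj₂ ascent) _ = ascent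

turn-free⇔ : ∀ {a b} (X : Mode → Set) →
  ((a ≡ plus × b ≡ minus × X free) ⊎ (a ≡ minus × b ≡ plus × X locked)) ⇔ (Turn free a b × X (after free a))
turn-free⇔ X = mk⇔ intro cases
  where
  intro : ∀ {a b} → (a ≡ plus × b ≡ minus × X free) ⊎ (a ≡ minus × b ≡ plus × X locked) →
          Turn free a b × X (after free a)
  intro (inj₁ (refl , refl , x)) = turn+- , x
  intro (inj₂ (refl , refl , x)) = turn-+ , x
  cases : ∀ {a b} → Turn free a b × X (after free a) →
          (a ≡ plus × b ≡ minus × X free) ⊎ (a ≡ minus × b ≡ plus × X locked)
  cases (turn+- , x) = inj₁ (refl , refl , x)
  cases (turn-+ , x) = inj₂ (refl , refl , x)

turn-locked⇔ : ∀ {a b} (X : Mode → Set) →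
  (a ≡ minus × b ≡ plus × X locked) ⇔ (Turn locked a b × X (after locked a))
turn-locked⇔ X = mk⇔ (λ { (refl , refl , x) → turn-+ , x }) (λ { (turn-+ , x) → refl , refl , x })

-- A Tail (k, is, js) is a lattice path with rows is and columns js, entered from above;
-- Allowed m i T says that it satisfies (C1)–(C5) when it enters row i in mode m.
module Tails {p d : ℕ} (ε : Fin p → Fin d → Sign) where

  Tail : Set
  Tail = Σ ℕ λ k → Vec (Fin p) k × Vec (Fin d) (suc k)

  column : Tail → Fin d
  column (_ , _ , j ∷ _) = j

  extend : Fin p → Fin d → Tail → Tail
  extend R C (k , is , js) = suc k , R ∷ is , C ∷ js

  extend-injective : ∀ R C → Injective _≡_ _≡_ (extend R C)
  extend-injective R C {_ , _ , _} {_ , _ , _} refl = refl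

  PlusFrom : ℕ → Fin d → Set
  PlusFrom i j = (x : Fin p) → i ≤ toℕ x → ε x j ≡ plus

  PlusBetween : ℕ → Fin p → Fin d → Set
  PlusBetween i r j = (x : Fin p) → i ≤ toℕ x → toℕ x < toℕ r → ε x j ≡ plus

  Allowed : Mode → ℕ → Tail → Set
  TurnsAt : Mode → Fin p → Fin d → Tail → Set

  Allowed m i (zero , [] , j ∷ []) = PlusFrom i j
  Allowed m i (suc k , r ∷ is , j ∷ js) = i ≤ toℕ r × PlusBetween i r j × TurnsAt m r j (k , is , js)

  TurnsAt m R C T =
    Turn m (ε R C) (ε R (column T)) × Allowed (after m (ε R C)) (suc (toℕ R)) T × toℕ C < toℕ (column T)

  -- From free and From locked are counted by N_{+-} and N_{-+}.
  From : Mode → ℕ → Fin d → Tail → Set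
  From m i C T = Allowed m i T × column T ≡ C

  -- Continuation minus free R j and Continuation plus locked R j are counted by N_+ and N_-:
  -- the possible rests of a turn in row R towards a column ≥ j.
  Continuation : Sign → Mode → Fin p → ℕ → Tail → Set
  Continuation s m R j T = ε R (column T) ≡ s × Allowed m (suc (toℕ R)) T × j ≤ toℕ (column T)

  plus-from : ∀ R C x → ε R C ≡ plus → toℕ R ≤ toℕ x → (toℕ R < toℕ x → ε x C ≡ plus) → ε x C ≡ plus
  plus-from R C x R-plus R≤x below with m≤n⇒m<n∨m≡n R≤x
  ... | inj₁ R<x = below R<x
  ... | inj₂ R≡x with toℕ-injective R≡x
  ... | refl = R-plus

  cell-decomposition : ∀ m R C T →
    ((ε R C ≡ plus × From m (suc (toℕ R)) C T) ⊎ (∃[ T′ ] TurnsAt m R C T′ × extend R C T′ ≡ T))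
    ⇔ From m (toℕ R) C T
  cell-decomposition m R C T = mk⇔ (intro T) (cases T)
    where
    intro : ∀ T → (ε R C ≡ plus × From m (suc (toℕ R)) C T) ⊎ (∃[ T′ ] TurnsAt m R C T′ × extend R C T′ ≡ T) →
            From m (toℕ R) C T
    intro _ (inj₂ ((_ , _ , _ ∷ _) , turns , refl)) = (≤-refl , (λ x R≤x x<R → ⊥-elim (<⇒≱ x<R R≤x)) , turns) , refl
    intro (zero , [] , .C ∷ []) (inj₁ (R-plus , below , refl)) =
      (λ x R≤x → plus-from R C x R-plus R≤x (below x)) , refl
    intro (suc k , r ∷ is , .C ∷ js) (inj₁ (R-plus , (R<r , between , turns) , refl)) =
      (<⇒≤ R<r , (λ x R≤x x<r → plus-from R C x R-plus R≤x (λ R<x → between x R<x x<r)) , turns) , refl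
    cases : ∀ T → From m (toℕ R) C T →
            (ε R C ≡ plus × From m (suc (toℕ R)) C T) ⊎ (∃[ T′ ] TurnsAt m R C T′ × extend R C T′ ≡ T)
    cases (zero , [] , .C ∷ []) (from , refl) = inj₁ (from R ≤-refl , (λ x R<x → from x (<⇒≤ R<x)) , refl)
    cases (suc k , r ∷ is , .C ∷ js) ((R≤r , between , turns) , refl) with m≤n⇒m<n∨m≡n R≤r
    ... | inj₁ R<r = inj₁ (between R ≤-refl R<r , (R<r , (λ x R<x → between x (<⇒≤ R<x)) , turns) , refl)
    ... | inj₂ R≡r with toℕ-injective R≡r
    ... | refl = inj₂ ((k , is , js) , turns , refl)

  step-not-turn : ∀ m R C T → ¬ Allowed m (suc (toℕ R)) (extend R C T)
  step-not-turn m R C (_ , _ , _ ∷ _) (R<R , _) = <-irrefl refl R<R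

  turnsAt-free⇔ : ∀ R C T →
    ((ε R C ≡ plus × Continuation minus free R (suc (toℕ C)) T) ⊎
     (ε R C ≡ minus × Continuation plus locked R (suc (toℕ C)) T)) ⇔ TurnsAt free R C T
  turnsAt-free⇔ R C T = turn-free⇔ (λ m → Allowed m (suc (toℕ R)) T × toℕ C < toℕ (column T))

  turnsAt-locked⇔ : ∀ R C T → (ε R C ≡ minus × Continuation plus locked R (suc (toℕ C)) T) ⇔ TurnsAt locked R C T
  turnsAt-locked⇔ R C T = turn-locked⇔ (λ m → Allowed m (suc (toℕ R)) T × toℕ C < toℕ (column T))

  continuation-step : ∀ s m R C T →
    (Continuation s m R (suc (toℕ C)) T ⊎ (ε R C ≡ s × From m (suc (toℕ R)) C T)) ⇔ Continuation s m R (toℕ C) T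
  continuation-step s m R C T = mk⇔ intro cases
    where
    intro : Continuation s m R (suc (toℕ C)) T ⊎ (ε R C ≡ s × From m (suc (toℕ R)) C T) → Continuation s m R (toℕ C) T
    intro (inj₁ (sign , allowed , C<c)) = sign , allowed , <⇒≤ C<c
    intro (inj₂ (sign , allowed , refl)) = sign , allowed , ≤-refl
    cases : Continuation s m R (toℕ C) T → Continuation s m R (suc (toℕ C)) T ⊎ (ε R C ≡ s × From m (suc (toℕ R)) C T)
    cases (sign , allowed , C≤c) with m≤n⇒m<n∨m≡n C≤c
    ... | inj₁ C<c = inj₁ (sign , allowed , C<c)
    ... | inj₂ C≡c with toℕ-injective C≡c
    ... | refl = inj₂ (sign , allowed , refl)

  continuation-beyond : ∀ s m R j T → d ≤ j → ¬ Continuation s m R j T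
  continuation-beyond s m R j T d≤j (_ , _ , j≤c) = <⇒≱ (toℕ<n (column T)) (≤-trans d≤j j≤c)

  StartsFrom : ℕ → Tail → Set
  StartsFrom j T = Allowed free 0 T × j ≤ toℕ (column T)

  start-step : ∀ C T → (StartsFrom (suc (toℕ C)) T ⊎ From free 0 C T) ⇔ StartsFrom (toℕ C) T
  start-step C T = mk⇔ intro cases
    where
    intro : StartsFrom (suc (toℕ C)) T ⊎ From free 0 C T → StartsFrom (toℕ C) T
    intro (inj₁ (allowed , C<c)) = allowed , <⇒≤ C<c
    intro (inj₂ (allowed , refl)) = allowed , ≤-refl
    cases : StartsFrom (toℕ C) T → StartsFrom (suc (toℕ C)) T ⊎ From free 0 C T
    cases (allowed , C≤c) with m≤n⇒m<n∨m≡n C≤c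
    ... | inj₁ C<c = inj₁ (allowed , C<c)
    ... | inj₂ C≡c = inj₂ (allowed , toℕ-injective (sym C≡c))

  bottom-unique : ∀ m i C → p ≤ i → ∀ T → From m i C T → (zero , [] , C ∷ []) ≡ T
  bottom-unique m i C p≤i (zero , [] , .C ∷ []) (_ , refl) = refl
  bottom-unique m i C p≤i (suc k , r ∷ _ , _ ∷ _) ((i≤r , _) , _) = ⊥-elim (<⇒≱ (toℕ<n r) (≤-trans p≤i i≤r))

module Counting {p d : ℕ} (ε : Fin p → Fin d → Sign) where
  open Tails ε
  open Counts ε

  CountIs-plus : {Q : Tail → Set} {n : ℕ} (s : Sign) → CountIs Q n → CountIs (λ T → s ≡ plus × Q T) (isPlus s * n)
  CountIs-plus {n = n} plus c = CountIs-subst (sym (*-identityˡ n)) (CountIs-cong (λ T → mk⇔ (refl ,_) proj₂) c)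
  CountIs-plus minus c = CountIs-empty λ { T (() , _) }

  CountIs-minus : {Q : Tail → Set} {n : ℕ} (s : Sign) → CountIs Q n → CountIs (λ T → s ≡ minus × Q T) (isMinus s * n)
  CountIs-minus {n = n} minus c = CountIs-subst (sym (*-identityˡ n)) (CountIs-cong (λ T → mk⇔ (refl ,_) proj₂) c)
  CountIs-minus plus c = CountIs-empty λ { T (() , _) }

  χ⁺-suc : ∀ R C → χ⁺ (suc (toℕ R)) (suc (toℕ C)) ≡ isPlus (ε R C)
  χ⁺-suc R C with toℕ R <? p | toℕ C <? d
  ... | yes R<p | yes C<d = cong₂ (λ x y → isPlus (ε x y)) (toℕ-injective (toℕ-fromℕ< R<p)) (toℕ-injective (toℕ-fromℕ< C<d))
  ... | no R≮p | _ = ⊥-elim (R≮p (toℕ<n R))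
  ... | yes _ | no C≮d = ⊥-elim (C≮d (toℕ<n C))

  χ⁻-suc : ∀ R C → χ⁻ (suc (toℕ R)) (suc (toℕ C)) ≡ isMinus (ε R C)
  χ⁻-suc R C with toℕ R <? p | toℕ C <? d
  ... | yes R<p | yes C<d = cong₂ (λ x y → isMinus (ε x y)) (toℕ-injective (toℕ-fromℕ< R<p)) (toℕ-injective (toℕ-fromℕ< C<d))
  ... | no R≮p | _ = ⊥-elim (R≮p (toℕ<n R))
  ... | yes _ | no C≮d = ⊥-elim (C≮d (toℕ<n C))

  -- Nc indexes N from the far corner: a rows and b columns remain below and right of (R, C).
  χ⁺-cell : ∀ {a b} R C → toℕ R + suc a ≡ p → toℕ C + suc b ≡ d → χ⁺ (p ∸ a) (d ∸ b) ≡ isPlus (ε R C)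
  χ⁺-cell R C eR eC = trans (cong₂ χ⁺ (∸-≡-suc eR) (∸-≡-suc eC)) (χ⁺-suc R C)

  χ⁻-cell : ∀ {a b} R C → toℕ R + suc a ≡ p → toℕ C + suc b ≡ d → χ⁻ (p ∸ a) (d ∸ b) ≡ isMinus (ε R C)
  χ⁻-cell R C eR eC = trans (cong₂ χ⁻ (∸-≡-suc eR) (∸-≡-suc eC)) (χ⁻-suc R C)

  count-bottom : ∀ m i C → p ≤ i → CountIs (From m i C) 1
  count-bottom m i C p≤i = CountIs-single (zero , [] , C ∷ [])
    ((λ x i≤x → ⊥-elim (<⇒≱ (toℕ<n x) (≤-trans p≤i i≤x))) , refl) (bottom-unique m i C p≤i)

  step-or-turn-disjoint : ∀ m R C T → ε R C ≡ plus × From m (suc (toℕ R)) C T →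
                          ¬ (∃[ T′ ] TurnsAt m R C T′ × extend R C T′ ≡ T)
  step-or-turn-disjoint m R C _ (_ , allowed , _) (T′ , _ , refl) = step-not-turn m R C T′ allowed

  signs-disjoint : ∀ {s : Sign} {X Y : Set} → s ≡ plus × X → ¬ (s ≡ minus × Y)
  signs-disjoint (refl , _) (() , _)

  continuation-disjoint : ∀ s m R C T → Continuation s m R (suc (toℕ C)) T → ¬ (ε R C ≡ s × From m (suc (toℕ R)) C T)
  continuation-disjoint s m R C T (_ , _ , C<c) (_ , _ , c≡C) = <-irrefl (cong toℕ (sym c≡C)) C<c

  count-free : ∀ a b i C → i + a ≡ p → toℕ C + suc b ≡ d → CountIs (From free i C) (Nc K+- a (suc b))
  count-locked : ∀ a b i C → i + a ≡ p → toℕ C + suc b ≡ d → CountIs (From locked i C) (Nc K-+ a (suc b))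
  count-free-cell : ∀ a b R C → toℕ R + suc a ≡ p → toℕ C + suc b ≡ d →
                    CountIs (From free (toℕ R) C) (Nc K+- (suc a) (suc b))
  count-locked-cell : ∀ a b R C → toℕ R + suc a ≡ p → toℕ C + suc b ≡ d →
                      CountIs (From locked (toℕ R) C) (Nc K-+ (suc a) (suc b))
  count-descent : ∀ a b R j → toℕ R + suc a ≡ p → j + b ≡ d →
                  CountIs (Continuation minus free R j) (Nc K+ (suc a) b)
  count-ascent : ∀ a b R j → toℕ R + suc a ≡ p → j + b ≡ d →
                 CountIs (Continuation plus locked R j) (Nc K- (suc a) b)

  count-free zero b i C eR eC = count-bottom free i C (≤-reflexive (trans (sym eR) (+-identityʳ i)))
  count-free (suc a) b i C eR eC with fromℕ-below i a eR
  ... | R , refl = count-free-cell a b R C eR eC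

  count-locked zero b i C eR eC = count-bottom locked i C (≤-reflexive (trans (sym eR) (+-identityʳ i)))
  count-locked (suc a) b i C eR eC with fromℕ-below i a eR
  ... | R , refl = count-locked-cell a b R C eR eC

  count-free-cell a b R C eR eC =
    CountIs-subst counts-agree
      (CountIs-cong (cell-decomposition free R C)
        (CountIs-⊎ (step-or-turn-disjoint free R C)
          (CountIs-plus (ε R C) (count-free a b (suc (toℕ R)) C (+-suc-shift eR) eC))
          (CountIs-image (extend R C) (extend-injective R C)
            (CountIs-cong (turnsAt-free⇔ R C)
              (CountIs-⊎ (λ T → signs-disjoint)
                (CountIs-plus (ε R C) (count-descent a b R (suc (toℕ C)) eR (+-suc-shift eC)))
                (CountIs-minus (ε R C) (count-ascent a b R (suc (toℕ C)) eR (+-suc-shift eC))))))))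
    where
    X Y Z : ℕ
    X = Nc K+- a (suc b)
    Y = Nc K+ (suc a) b
    Z = Nc K- (suc a) b
    open ≡-Reasoning
    counts-agree : isPlus (ε R C) * X + (isPlus (ε R C) * Y + isMinus (ε R C) * Z) ≡ Nc K+- (suc a) (suc b)
    counts-agree = begin
      isPlus (ε R C) * X + (isPlus (ε R C) * Y + isMinus (ε R C) * Z)
        ≡⟨ +-assoc (isPlus (ε R C) * X) (isPlus (ε R C) * Y) (isMinus (ε R C) * Z) ⟨
      isPlus (ε R C) * X + isPlus (ε R C) * Y + isMinus (ε R C) * Z
        ≡⟨ cong₂ (λ u v → u * X + u * Y + v * Z) (χ⁺-cell R C eR eC) (χ⁻-cell R C eR eC) ⟨
      Nc K+- (suc a) (suc b) ∎

  count-locked-cell a b R C eR eC =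
    CountIs-subst counts-agree
      (CountIs-cong (cell-decomposition locked R C)
        (CountIs-⊎ (step-or-turn-disjoint locked R C)
          (CountIs-plus (ε R C) (count-locked a b (suc (toℕ R)) C (+-suc-shift eR) eC))
          (CountIs-image (extend R C) (extend-injective R C)
            (CountIs-cong (turnsAt-locked⇔ R C)
              (CountIs-minus (ε R C) (count-ascent a b R (suc (toℕ C)) eR (+-suc-shift eC)))))))
    where
    counts-agree : isPlus (ε R C) * Nc K-+ a (suc b) + isMinus (ε R C) * Nc K- (suc a) b ≡ Nc K-+ (suc a) (suc b)
    counts-agree = trans (+-comm (isPlus (ε R C) * Nc K-+ a (suc b)) (isMinus (ε R C) * Nc K- (suc a) b))
      (sym (cong₂ (λ u v → v * Nc K- (suc a) b + u * Nc K-+ a (suc b)) (χ⁺-cell R C eR eC) (χ⁻-cell R C eR eC)))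

  count-descent a zero R j eR eC = CountIs-empty λ T →
    continuation-beyond minus free R j T (≤-reflexive (trans (sym eC) (+-identityʳ j)))
  count-descent a (suc b) R j eR eC with fromℕ-below j b eC
  ... | C , refl =
    CountIs-subst (cong (λ u → Nc K+ (suc a) b + u * Nc K+- a (suc b)) (sym (χ⁻-cell R C eR eC)))
      (CountIs-cong (continuation-step minus free R C)
        (CountIs-⊎ (continuation-disjoint minus free R C)
          (count-descent a b R (suc (toℕ C)) eR (+-suc-shift eC))
          (CountIs-minus (ε R C) (count-free a b (suc (toℕ R)) C (+-suc-shift eR) eC))))

  count-ascent a zero R j eR eC = CountIs-empty λ T →
    continuation-beyond plus locked R j T (≤-reflexive (trans (sym eC) (+-identityʳ j)))
  count-ascent a (suc b) R j eR eC with fromℕ-below j b eC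
  ... | C , refl =
    CountIs-subst (cong (λ u → Nc K- (suc a) b + u * Nc K-+ a (suc b)) (sym (χ⁺-cell R C eR eC)))
      (CountIs-cong (continuation-step plus locked R C)
        (CountIs-⊎ (continuation-disjoint plus locked R C)
          (count-ascent a b R (suc (toℕ C)) eR (+-suc-shift eC))
          (CountIs-plus (ε R C) (count-locked a b (suc (toℕ R)) C (+-suc-shift eR) eC))))

  count-top : ∀ b j → j + b ≡ d → CountIs (StartsFrom j) (N₁c b)
  count-top zero j eC = CountIs-empty λ T (_ , j≤c) →
    <⇒≱ (toℕ<n (column T)) (≤-trans (≤-reflexive (trans (sym eC) (+-identityʳ j))) j≤c)
  count-top (suc b) j eC with fromℕ-below j b eC
  ... | C , refl =
    CountIs-subst (cong (λ u → N₁c b + Nc K+- p u) (sym (suc-∸-∸-≡-suc eC)))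
      (CountIs-cong (start-step C)
        (CountIs-⊎ (λ { T (_ , C<c) (_ , refl) → <-irrefl refl C<c })
          (count-top b (suc (toℕ C)) (+-suc-shift eC))
          (count-free p b 0 C refl eC)))

  count-allowed : CountIs (Allowed free 0) (N₁c d)
  count-allowed = CountIs-cong (λ T → mk⇔ proj₁ (_, z≤n)) (count-top d 0 refl)

module Paths {p d : ℕ} (ε : Fin p → Fin d → Sign) where
  open Tails ε

  record Conditions (m : Mode) (i k : ℕ) (is : Vec (Fin p) k) (js : Vec (Fin d) (suc k)) : Set where
    I : Fin k → Fin p
    I r = lookup is r
    J : Fin (suc k) → Fin d
    J r = lookup js r
    field
      C1 : (r : Fin k) → toℕ r ≡ 0 → (x : Fin p) → i ≤ toℕ x → toℕ x < toℕ (I r) → ε x (J (inject₁ r)) ≡ plus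
      C2 : (r : Fin k) → suc (toℕ r) ≡ k → (x : Fin p) → toℕ (I r) < toℕ x → ε x (J (fromℕ k)) ≡ plus
      C2₀ : k ≡ 0 → (x : Fin p) → i ≤ toℕ x → ε x (J (fromℕ k)) ≡ plus
      C3 : (s t : Fin k) → toℕ t ≡ suc (toℕ s) →
           (x : Fin p) → toℕ (I s) < toℕ x → toℕ x < toℕ (I t) → ε x (J (inject₁ t)) ≡ plus
      C4 : (r : Fin k) → Turns (ε (I r) (J (inject₁ r))) (ε (I r) (J (fsuc r)))
      C5 : (r s : Fin k) → toℕ r ≤ toℕ s →
           Ascent (ε (I r) (J (inject₁ r))) (ε (I r) (J (fsuc r))) → Ascent (ε (I s) (J (inject₁ s))) (ε (I s) (J (fsuc s)))
      C6 : m ≡ locked → (r : Fin k) → Ascent (ε (I r) (J (inject₁ r))) (ε (I r) (J (fsuc r)))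

  Conditions-tail : ∀ {m i k r j is js} → Conditions m i (suc k) (r ∷ is) (j ∷ js) →
                    Conditions (after m (ε r j)) (suc (toℕ r)) k is js
  Conditions-tail {m} {k = k} {r} {j} {is} {js} c = record
    { C1 = λ s e → C3 fzero (fsuc s) (cong suc e)
    ; C2 = λ s e → C2 (fsuc s) (cong suc e)
    ; C2₀ = λ e → C2 fzero (cong suc (sym e))
    ; C3 = λ s t e → C3 (fsuc s) (fsuc t) (cong suc e)
    ; C4 = λ s → C4 (fsuc s)
    ; C5 = λ s t s≤t → C5 (fsuc s) (fsuc t) (s≤s s≤t)
    ; C6 = λ e → ascent-after (after≡locked⇒ m (ε r j) e)
    }
    where
    open Conditions c
    ascent-after : m ≡ locked ⊎ ε r j ≡ minus → (s : Fin k) →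
                   Ascent (ε (lookup is s) (lookup js (inject₁ s))) (ε (lookup is s) (lookup js (fsuc s)))
    ascent-after (inj₁ m-locked) s = C6 m-locked (fsuc s)
    ascent-after (inj₂ r-minus) s = C5 fzero (fsuc s) z≤n (Turns-minus⇒Ascent (C4 fzero) r-minus)

  Conditions⇒Allowed : ∀ {m i k is js} → Conditions m i k is js → IncreasingFrom i is → Increasing js →
                       Allowed m i (k , is , js)
  Conditions⇒Allowed {k = zero} {[]} {j ∷ []} c _ _ = Conditions.C2₀ c refl
  Conditions⇒Allowed {m} {k = suc k} {r ∷ is} {j ∷ js@(_ ∷ _)} c (i≤r , rows) (j<j′ , columns) =
    i≤r , C1 fzero refl , Turns⇒Turn m (C4 fzero) (λ e → C6 e fzero) ,
    Conditions⇒Allowed (Conditions-tail c) rows columns , j<j′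
    where open Conditions c

  Allowed⇒Conditions : ∀ {m i k is js} → Allowed m i (k , is , js) → Conditions m i k is js
  Allowed⇒Conditions {k = zero} {[]} {j ∷ []} below = record
    { C1 = λ () ; C2 = λ () ; C2₀ = λ _ → below ; C3 = λ () ; C4 = λ () ; C5 = λ () ; C6 = λ _ () }
  Allowed⇒Conditions {m} {k = suc k} {r ∷ is} {j ∷ js@(_ ∷ _)} (_ , between , turn , rest , _) = record
    { C1 = λ { fzero _ → between ; (fsuc s) () }
    ; C2 = λ { fzero e → C2₀ (sym (suc-injective e)) ; (fsuc s) e → C2 s (suc-injective e) }
    ; C2₀ = λ ()
    ; C3 = λ { s fzero () ; fzero (fsuc t) e → C1 t (suc-injective e) ; (fsuc s) (fsuc t) e → C3 s t (suc-injective e) }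
    ; C4 = λ { fzero → Turn⇒Turns turn ; (fsuc s) → C4 s }
    ; C5 = λ { fzero fzero _ ascent → ascent
             ; fzero (fsuc t) _ ascent → C6 (cong (after m) (proj₁ ascent)) t
             ; (fsuc s) (fsuc t) (s≤s s≤t) → C5 s t s≤t }
    ; C6 = λ { refl fzero → Turn-locked⇒Ascent turn ; refl (fsuc s) → C6 (after-locked (ε r j)) s }
    }
    where open Conditions (Allowed⇒Conditions rest)

  Allowed⇒Increasing : ∀ {m i k is js} → Allowed m i (k , is , js) → IncreasingFrom i is × Increasing js
  Allowed⇒Increasing {k = zero} {[]} {_ ∷ []} _ = tt , tt
  Allowed⇒Increasing {k = suc k} {_ ∷ _} {_ ∷ _ ∷ _} (i≤r , _ , _ , rest , j<j′) =
    (i≤r , proj₁ (Allowed⇒Increasing rest)) , j<j′ , proj₂ (Allowed⇒Increasing rest)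

  tail : LatticePath p d → Tail
  tail π = LatticePath.k π , LatticePath.is π , LatticePath.js π

  tail-injective : Injective _≡_ _≡_ tail
  tail-injective {mkPath k is js is↑ js↑} {mkPath _ _ _ is↑′ js↑′} refl =
    cong₂ (mkPath k is js) (Increasing-irrelevant is is↑ is↑′) (Increasing-irrelevant js js↑ js↑′)

  TropAllowed⇒Allowed : ∀ π → TropAllowed ε π → Allowed free 0 (tail π)
  TropAllowed⇒Allowed (mkPath k is js is↑ js↑) allowed =
    Conditions⇒Allowed conditions (Increasing⇒IncreasingFrom₀ is↑) js↑
    where
    open TropAllowed allowed
    conditions : Conditions free 0 k is js
    conditions = record
      { C1 = λ r e x _ → C1 r e x ; C2 = C2 ; C2₀ = λ e x _ → C2₀ e x
      ; C3 = C3 ; C4 = C4 ; C5 = C5 ; C6 = λ () }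

  Allowed⇒TropAllowed : ∀ T → Allowed free 0 T → Σ (LatticePath p d) λ π → TropAllowed ε π × tail π ≡ T
  Allowed⇒TropAllowed (k , is , js) allowed =
    mkPath k is js (IncreasingFrom⇒Increasing (proj₁ increasing)) (proj₂ increasing) , tropAllowed , refl
    where
    increasing : IncreasingFrom 0 is × Increasing js
    increasing = Allowed⇒Increasing allowed
    open Conditions (Allowed⇒Conditions allowed)
    tropAllowed : TropAllowed ε _
    tropAllowed = record
      { C1 = λ r e x → C1 r e x z≤n ; C2 = C2 ; C2₀ = λ e x → C2₀ e x z≤n
      ; C3 = C3 ; C4 = C4 ; C5 = C5 }

corollary16 : (p d : ℕ) → 1 ≤ p → 1 ≤ d → (ε : Fin p → Fin d → Sign) →
    CountIs (TropAllowed ε) (Counts.N₁₀ ε 1)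
corollary16 p d _ _ ε =
  CountIs-transport tail tail-injective TropAllowed⇒Allowed Allowed⇒TropAllowed count-allowed
  where
  open Paths ε
  open Counting ε
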